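{- Let $\mathbb{T}=(\Sigma,\mathcal{E})$ be a graded theory. Assume that $\Gamma\vdash_k s\le t$ is derivable and let $\sigma(f)\in\mathsf{sub}(s,t)$ where $f\colon|\mathrm{ar}(\sigma)|\to\mathsf{T}_{\Sigma,n}(\Gamma)$. Then $\Gamma\vdash_n f(i)\le f(j)$ is derivable for all $i\le j$ in $\mathrm{ar}(\sigma)$.
   Context: A graded signature $\Sigma$: sets $\Sigma(P,n)$ of operation symbols for finite posets $P$ and $n\in\omega$; $\mathrm{ar}(\sigma)=P$, $d(\sigma)=n$; $|P|$ is the underlying set of $P$. Terms $\mathsf{T}_{\Sigma,k}(\Gamma)$ over a poset $\Gamma$: each $x\in\Gamma$ has depth $0$; for $\sigma\in\Sigma(P,k)$ and any function $f\colon|P|\to\mathsf{T}_{\Sigma,m}(\Gamma)$, $\sigma(f)$ has depth $k+m$. Subterms: $\mathsf{sub}(x)=\{x\}$, $\mathsf{sub}(\sigma(f))=\{\sigma(f)\}\cup\bigcup_i\mathsf{sub}(f(i))$, $\mathsf{sub}(s,t)=\mathsf{sub}(s)\cup\mathsf{sub}(t)$. An inequation in context $\Gamma\vdash_k s\le t$ is a pair $s,t\in\mathsf{T}_{\Sigma,k}(\Gamma)$; $\Gamma\vdash_k{\downarrow}t$ means $\Gamma\vdash_k t\le t$. A graded theory $\mathbb{T}=(\Sigma,\mathcal{E})$ consists of $\Sigma$ and a set $\mathcal{E}$ of inequations in context (axioms). A uniform substitution $\gamma\colon|\Delta|\to\mathsf{T}_{\Sigma,k}(\Gamma)$ extends to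 $\bar\gamma\colon\mathsf{T}_{\Sigma,p}(\Delta)\to\mathsf{T}_{\Sigma,k+p}(\Gamma)$ by $\bar\gamma(x)=\gamma(x)$, $\bar\gamma(\sigma(f))=\sigma(\bar\gamma\cdot f)$. Derivability rules: (Var) $\Gamma\vdash_0 x\le y$ for $x\le y$ in $\Gamma$. (Ar) for $f\colon|\mathrm{ar}(\sigma)|\to\mathsf{T}_{\Sigma,k}(\Gamma)$: from $\Gamma\vdash_k f(i)\le f(j)$ for all $i\le j$ in $\mathrm{ar}(\sigma)$ infer $\Gamma\vdash_{k+d(\sigma)}{\downarrow}\sigma(f)$. (Trans) from $\Gamma\vdash_k s\le t$, $\Gamma\vdash_k t\le u$ infer $\Gamma\vdash_k s\le u$. (Mon) for $f,g\colon|\mathrm{ar}(\sigma)|\to\mathsf{T}_{\Sigma,k}(\Gamma)$: from $\Gamma\vdash_k f(i)\le g(i)$ for all $i$, $\Gamma\vdash_{k+d(\sigma)}{\downarrow}\sigma(f)$, $\Gamma\vdash_{k+d(\sigma)}{\downarrow}\sigma(g)$ infer $\Gamma\vdash_{k+d(\sigma)}\sigma(f)\le\sigma(g)$. (Ax1) for an axiom $\Delta\vdash_n s\le t$ in $\mathcal{E}$ and $\gamma\colon|\Delta|\to\mathsf{T}_{\Sigma,k}(\Gamma)$: from $\Gamma\vdash_k\gamma(x)\le\gamma(y)$ for all $x\le y$ in $\Delta$ infer $\Gamma\vdash_{n+k}\bar\gamma(s)\le\bar\gamma(t)$. (Ax2) for an axiom $\Delta\vdash_n s\le t$ in $\mathcal{E}$,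 $\sigma(f)\in\mathsf{sub}(s,t)$ with $f\colon|\mathrm{ar}(\sigma)|\to\mathsf{T}_{\Sigma,m}(\Delta)$, $i\le j$ in $\mathrm{ar}(\sigma)$, and $\gamma\colon|\Delta|\to\mathsf{T}_{\Sigma,k}(\Gamma)$: from $\Gamma\vdash_k\gamma(x)\le\gamma(y)$ for all $x\le y$ in $\Delta$ infer $\Gamma\vdash_{m+k}\bar\gamma(f(i))\le\bar\gamma(f(j))$. -}

module Defs where

open import Data.Nat using (ℕ; _+_)
open import Data.Nat.Properties using (+-assoc)
open import Data.Fin using (Fin)
open import Data.Sum using (_⊎_)
open import Relation.Binary.Structures using (IsPartialOrder)
open import Relation.Binary.PropositionalEquality using (_≡_; subst; sym)

record Pos : Set₁ where
  field
    Carrier        : Set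
    _≤_            : Carrier → Carrier → Set
    isPartialOrder : IsPartialOrder _≡_ _≤_
open Pos public renaming (Carrier to ∣_∣)

record FinPoset : Set₁ where
  field
    size           : ℕ
    _≤_            : Fin size → Fin size → Set
    isPartialOrder : IsPartialOrder _≡_ _≤_
open FinPoset public using (size)

-- Graded signature: the disjoint union of the sets Σ(P,n), with ar and d.
record Signature : Set₁ where
  field
    Op : Set
    ar : Op → FinPoset
    d  : Op → ℕ
open Signature public

module _ (S : Signature) where

  data Term (V : Set) : ℕ → Set where
    var : V → Term V 0
    op  : ∀ {m} (σ : Op S) → (Fin (size (ar S σ)) → Term V m) → Term V (d S σ + m)

  data Sub {V : Set} {m : ℕ} (u : Term V m) : ∀ {k} → Term V k → Set where
    here  : Sub u u
    there : ∀ {n} (σ : Op S) (f : Fin (size (ar S σ)) → Term V n) (i : Fin (size (ar S σ)))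
          → Sub u (f i) → Sub u (op σ f)

  Sub₂ : ∀ {V m k} → Term V m → Term V k → Term V k → Set
  Sub₂ u s t = Sub u s ⊎ Sub u t

  substT : ∀ {Δ Γ : Set} {k} → (Δ → Term Γ k) → ∀ {p} → Term Δ p → Term Γ (p + k)
  substT γ (var x) = γ x
  substT {k = k} γ (op {m} σ f) =
    subst (Term _) (sym (+-assoc (d S σ) m k)) (op σ (λ i → substT γ (f i)))

record Theory : Set₁ where
  field
    sig  : Signature
    Ax   : Set
    ctx  : Ax → Pos
    dep  : Ax → ℕ
    lhs  : (a : Ax) → Term sig ∣ ctx a ∣ (dep a)
    rhs  : (a : Ax) → Term sig ∣ ctx a ∣ (dep a)
open Theory public

module _ (T : Theory) where
  private S = sig T

  data Der (Γ : Pos) : (k : ℕ) → Term S ∣ Γ ∣ k → Term S ∣ Γ ∣ k → Set where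
    Var   : ∀ {x y} → _≤_ Γ x y → Der Γ 0 (var x) (var y)
    Ar    : ∀ {k} (σ : Op S) (f : Fin (size (ar S σ)) → Term S ∣ Γ ∣ k)
          → (∀ i j → FinPoset._≤_ (ar S σ) i j → Der Γ k (f i) (f j))
          → Der Γ (d S σ + k) (op σ f) (op σ f)
    Trans : ∀ {k s t u} → Der Γ k s t → Der Γ k t u → Der Γ k s u
    Mon   : ∀ {k} (σ : Op S) (f g : Fin (size (ar S σ)) → Term S ∣ Γ ∣ k)
          → (∀ i → Der Γ k (f i) (g i))
          → Der Γ (d S σ + k) (op σ f) (op σ f)
          → Der Γ (d S σ + k) (op σ g) (op σ g)
          → Der Γ (d S σ + k) (op σ f) (op σ g)
    Ax1   : ∀ {k} (a : Ax T) (γ : ∣ ctx T a ∣ → Term S ∣ Γ ∣ k)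
          → (∀ x y → _≤_ (ctx T a) x y → Der Γ k (γ x) (γ y))
          → Der Γ (dep T a + k) (substT S γ (lhs T a)) (substT S γ (rhs T a))
    Ax2   : ∀ {k m} (a : Ax T) (σ : Op S) (f : Fin (size (ar S σ)) → Term S ∣ ctx T a ∣ m)
          → Sub₂ S (op σ f) (lhs T a) (rhs T a)
          → (i j : Fin (size (ar S σ))) → FinPoset._≤_ (ar S σ) i j
          → (γ : ∣ ctx T a ∣ → Term S ∣ Γ ∣ k)
          → (∀ x y → _≤_ (ctx T a) x y → Der Γ k (γ x) (γ y))
          → Der Γ (m + k) (substT S γ (f i)) (substT S γ (f j))

{-# OPTIONS --safe #-}
-- Call a term hereditary when every operation subterm σ(f) of it has derivably
-- ordered arguments: Γ ⊢ f(i) ≤ f(j) for all i ≤ j in ar(σ).  Both sides of a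
-- derivable inequation are hereditary, by induction on the derivation.  (Ar) has the
-- argument inequations as premises and (Mon) has Γ ⊢ ↓σ(f), Γ ⊢ ↓σ(g); for an
-- instance γ̄(s) of an axiom side, the subterms γ(x) are hereditary because
-- Γ ⊢ γ(x) ≤ γ(x) is a premise, and the subterms γ̄(σ(f)) are covered by (Ax2).
module Submission where

open import Defs
open import Data.Nat using (ℕ)
open import Data.Fin using (Fin)
open import Data.Unit using (⊤; tt)
open import Data.Product using (_×_; _,_; proj₁; proj₂)
open import Data.Sum using (inj₁; inj₂)
import Data.Sum as Sum
open import Relation.Binary.PropositionalEquality using (_≡_; refl; subst)
open import Relation.Binary.Structures using (IsPartialOrder)

sub-trans : ∀ {S : Signature} {V : Set} {m n k} {u : Term S V m} {v : Term S V n} {t : Term S V k}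
          → Sub S u v → Sub S v t → Sub S u t
sub-trans p here            = p
sub-trans p (there σ f i q) = there σ f i (sub-trans p q)

sub₂-trans : ∀ {S : Signature} {V : Set} {m n k} {u : Term S V m} {v : Term S V n} {s t : Term S V k}
           → Sub S u v → Sub₂ S v s t → Sub₂ S u s t
sub₂-trans p = Sum.map (sub-trans p) (sub-trans p)

module _ {S : Signature} {V : Set} (R : ∀ {m} → Term S V m → Term S V m → Set) where

  ArgsRelated : ∀ {k} → Term S V k → Set
  ArgsRelated (var x)  = ⊤
  ArgsRelated (op σ f) = ∀ i j → FinPoset._≤_ (ar S σ) i j → R (f i) (f j)

  data Hereditary : ∀ {k} → Term S V k → Set where
    var : ∀ {x} → Hereditary (var x)
    op  : ∀ {m} σ (f : Fin (size (ar S σ)) → Term S V m)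
        → ArgsRelated (op σ f) → (∀ i → Hereditary (f i)) → Hereditary (op σ f)

  hereditary-argsRelated : ∀ {k} {t : Term S V k} → Hereditary t → ArgsRelated t
  hereditary-argsRelated var          = tt
  hereditary-argsRelated (op σ f r _) = r

  hereditary-sub : ∀ {m k} {u : Term S V m} {t : Term S V k}
                 → Hereditary t → Sub S u t → ArgsRelated u
  hereditary-sub h            here            = hereditary-argsRelated h
  hereditary-sub (op σ f _ h) (there σ f i p) = hereditary-sub (h i) p

  hereditary-fromSubterms : ∀ {k} (t : Term S V k)
                          → (∀ {m} {u : Term S V m} → Sub S u t → ArgsRelated u) → Hereditary t
  hereditary-fromSubterms (var x)  _ = var
  hereditary-fromSubterms (op σ f) r =
    op σ f (r here) λ i → hereditary-fromSubterms (f i) λ p → r (there σ f i p)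

  hereditary-subst : ∀ {a b} (e : a ≡ b) {t : Term S V a}
                   → Hereditary t → Hereditary (subst (Term S V) e t)
  hereditary-subst refl h = h

module _ (T : Theory) (Γ : Pos) where
  private
    S = sig T

    Derivable : ∀ {m} → Term S ∣ Γ ∣ m → Term S ∣ Γ ∣ m → Set
    Derivable = Der T Γ _

    DerivableAfter : ∀ {Δ : Set} {k} → (Δ → Term S ∣ Γ ∣ k) → ∀ {p} → Term S Δ p → Term S Δ p → Set
    DerivableAfter γ s t = Der T Γ _ (substT S γ s) (substT S γ t)

  hereditary-substT : ∀ {Δ : Set} {k} (γ : Δ → Term S ∣ Γ ∣ k)
                    → (∀ x → Hereditary Derivable (γ x))
                    → ∀ {p} {t : Term S Δ p} → Hereditary (DerivableAfter γ) t
                    → Hereditary Derivable (substT S γ t)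
  hereditary-substT γ hγ {t = var x} var = hγ x
  hereditary-substT γ hγ (op σ f r h) =
    hereditary-subst Derivable _
      (op σ (λ i → substT S γ (f i)) r λ i → hereditary-substT γ hγ (h i))

  module _ (a : Ax T) {k : ℕ} (γ : ∣ ctx T a ∣ → Term S ∣ Γ ∣ k)
           (γ-mono : ∀ x y → _≤_ (ctx T a) x y → Der T Γ k (γ x) (γ y)) where

    hereditary-axiomSubterm : ∀ {p} (t : Term S ∣ ctx T a ∣ p)
                            → (∀ {m} {u : Term S ∣ ctx T a ∣ m} → Sub S u t → Sub₂ S u (lhs T a) (rhs T a))
                            → Hereditary (DerivableAfter γ) t
    hereditary-axiomSubterm t inAxiom = hereditary-fromSubterms (DerivableAfter γ) t argsRelated
      where
        argsRelated : ∀ {m} {u : Term S ∣ ctx T a ∣ m} → Sub S u t → ArgsRelated (DerivableAfter γ) u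
        argsRelated {u = var x}  _ = tt
        argsRelated {u = op σ f} p = λ i j i≤j → Ax2 a σ f (inAxiom p) i j i≤j γ γ-mono

  γ-hereditary : ∀ {a k} {γ : ∣ ctx T a ∣ → Term S ∣ Γ ∣ k}
               → (∀ x y → _≤_ (ctx T a) x y → Der T Γ k (γ x) (γ y))
               → ∀ x → Hereditary Derivable (γ x)

  der-hereditary : ∀ {k s t} → Der T Γ k s t → Hereditary Derivable s × Hereditary Derivable t
  der-hereditary (Var _)              = var , var
  der-hereditary (Ar σ f args)        = h , h
    where
      h : Hereditary Derivable (op σ f)
      h = op σ f args λ i →
        proj₁ (der-hereditary (args i i (IsPartialOrder.refl (FinPoset.isPartialOrder (ar S σ)))))
  der-hereditary (Trans p q)          = proj₁ (der-hereditary p) , proj₂ (der-hereditary q)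
  der-hereditary (Mon σ f g _ p q)    = proj₁ (der-hereditary p) , proj₁ (der-hereditary q)
  der-hereditary (Ax1 a γ γ-mono)     =
    hereditary-substT γ (γ-hereditary γ-mono) (hereditary-axiomSubterm a γ γ-mono (lhs T a) inj₁) ,
    hereditary-substT γ (γ-hereditary γ-mono) (hereditary-axiomSubterm a γ γ-mono (rhs T a) inj₂)
  der-hereditary (Ax2 a σ f p i j _ γ γ-mono) = argument i , argument j
    where
      argument : ∀ l → Hereditary Derivable (substT S γ (f l))
      argument l = hereditary-substT γ (γ-hereditary γ-mono)
        (hereditary-axiomSubterm a γ γ-mono (f l) λ q → sub₂-trans (sub-trans q (there σ f l here)) p)

  γ-hereditary {a} γ-mono x =
    proj₁ (der-hereditary (γ-mono x x (IsPartialOrder.refl (isPartialOrder (ctx T a)))))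

mainTheorem5 : (T : Theory) (Γ : Pos) (k : ℕ) (s t : Term (sig T) ∣ Γ ∣ k)
    → Der T Γ k s t
    → (σ : Op (sig T)) (n : ℕ) (f : Fin (size (ar (sig T) σ)) → Term (sig T) ∣ Γ ∣ n)
    → Sub₂ (sig T) (op σ f) s t
    → (i j : Fin (size (ar (sig T) σ))) → FinPoset._≤_ (ar (sig T) σ) i j
    → Der T Γ n (f i) (f j)
mainTheorem5 T Γ k s t s≤t σ n f (inj₁ p) = hereditary-sub (Der T Γ _) (proj₁ (der-hereditary T Γ s≤t)) p
mainTheorem5 T Γ k s t s≤t σ n f (inj₂ p) = hereditary-sub (Der T Γ _) (proj₂ (der-hereditary T Γ s≤t)) p
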